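{- Let $\Gamma$ be a connected simple graph on $[n]$, and let $M\subseteq[n]$ be a subset of maximal cardinality such that the induced subgraph $\Gamma|_M$ is isomorphic to the path graph $L_{|M|}$. Then for all $k\ge|M|$, $\Psi^k_q(\Gamma^{\mathbf 1})=\Psi^{|M|-1}_q(\Gamma^{\mathbf 1})$.
   Context: $L_r$ is the path (line) graph on $[r]$ with edges $\{i,i+1\}$. $\Gamma^{\mathbf 1}$ is $\Gamma$ with every edge decorated by $1$. For a decorated graph $\Gamma^w$ (a simple graph with edge map $w:E\to\mathbb{N}$) and $S\subseteq V$: $\Gamma^w|_S$ is the induced decorated subgraph; $\Gamma^w/S$ is the decorated graph on $V\setminus S$ consisting of the induced edges plus an edge $uv$ for every pair $u,v\notin S$ joined by a path with all interior vertices in $S$, decorated by the minimum total decoration over such paths. $\mathrm{pr}_m$ deletes all edges of decoration $>m$. A flag is a strict chain $\mathcal F:\emptyset=F_0\subset F_1\subset\cdots\subset F_k=[n]$, of type $(|F_1|-|F_0|,\ldots,|F_k|-|F_{k-1}|)$, and $M_{\mathcal F}=M_{\mathsf{type}(\mathcal F)}$ is the monomial quasisymmetric function. With $\mathsf{rk}_m(\Gamma^w/\mathcal F)=n-\sum_{i=1}^k c(\mathrm{pr}_m(\Gamma^w|_{F_i}/F_{i-1}))$ ($c$ = number of connected components), $\Psi^m_q(\Gamma^w)=\sum_{\mathcal F}q^{\mathsf{rk}_m(\Gamma^w/\mathcal F)}M_{\mathcal F}$, summed over all flags of $[n]$. -}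

module Defs where

open import Data.Nat using (ℕ; zero; suc; _+_; _∸_)
open import Data.Bool using (Bool; true; false; T)
open import Data.Fin using (Fin; toℕ)
open import Data.Fin.Subset using (Subset; _∈_; _∉_; _⊂_; _∩_; ⊥; ⊤; ∣_∣)
open import Data.List using (List; []; _∷_; length)
open import Data.Nat.ListAction using (sum)
open import Data.List.Membership.Propositional using () renaming (_∈_ to _∈ₗ_)
open import Data.List.Relation.Unary.Unique.Propositional using (Unique)
open import Data.Product using (Σ; ∃; _×_; _,_)
open import Relation.Binary.PropositionalEquality using (_≡_; _≢_)
open import Relation.Binary.Construct.Closure.ReflexiveTransitive using (Star)
open import Function using (_⇔_)
open import Function.Definitions using (Injective)

-- Finite cardinality, stated relationally:
-- Card P k  means  {x | P x} is finite with exactly k elements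
-- (a duplicate-free list enumerating exactly the x with P x).

Card : {A : Set} → (A → Set) → ℕ → Set
Card {A} P k = Σ (List A) λ xs → Unique xs × (∀ x → (x ∈ₗ xs) ⇔ P x) × length xs ≡ k

record SimpleGraph (n : ℕ) : Set where
  field
    adj    : Fin n → Fin n → Bool
    sym    : ∀ u v → adj u v ≡ adj v u
    irrefl : ∀ u → adj u u ≡ false

open SimpleGraph public

Adj : ∀ {n} → SimpleGraph n → Fin n → Fin n → Set
Adj Γ u v = T (adj Γ u v)

Connected : ∀ {n} → SimpleGraph n → Set
Connected Γ = ∀ u v → Star (Adj Γ) u v

-- decorated graph: a simple graph together with an edge map w : E → ℕ
-- (given as a symmetric function on pairs; only its values on edges matter)
record DecGraph (n : ℕ) : Set where
  field
    graph : SimpleGraph n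
    w     : Fin n → Fin n → ℕ
    w-sym : ∀ u v → w u v ≡ w v u

open DecGraph public

_^𝟏 : ∀ {n} → SimpleGraph n → DecGraph n
Γ ^𝟏 = record { graph = Γ ; w = λ _ _ → 1 ; w-sym = λ _ _ → Relation.Binary.PropositionalEquality.refl }

LAdj : ∀ {r} → Fin r → Fin r → Set
LAdj i j = (toℕ j ≡ suc (toℕ i)) Data.Sum.⊎ (toℕ i ≡ suc (toℕ j))
  where import Data.Sum

-- Γ|_M is isomorphic to L_{|M|}: there is a bijection f : [|M|] → M
-- with  f i ~ f j in Γ  iff  {i,j} is an edge of L_{|M|}.
InducedPath : ∀ {n} → SimpleGraph n → Subset n → Set
InducedPath {n} Γ M =
  Σ (Fin ∣ M ∣ → Fin n) λ f →
      (∀ i → f i ∈ M)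
    × Injective _≡_ _≡_ f
    × (∀ x → x ∈ M → ∃ λ i → f i ≡ x)
    × (∀ i j → Adj Γ (f i) (f j) ⇔ LAdj i j)

-- Walks used in Γ^w|_F / S : walks u = x₀ ~ x₁ ~ … ~ x_l = v (l ≥ 1)
-- in Γ whose interior vertices all lie in the set I, with total
-- decoration d.

data IWalk {n} (G : DecGraph n) (I : Subset n) : Fin n → Fin n → ℕ → Set where
  edge : ∀ {u v} → Adj (graph G) u v → IWalk G I u v (w G u v)
  step : ∀ {u x v d} → Adj (graph G) u x → x ∈ I → IWalk G I x v d →
         IWalk G I u v (w G u x + d)

-- Edge relation of pr_m(Γ^w|_F / S), a graph on the vertex set F \ S:
-- u ≠ v in F \ S are joined in Γ^w|_F / S by an edge whose decoration
-- is the minimum total decoration of a path with interior in S (∩ F);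
-- pr_m keeps it iff that minimum is ≤ m, i.e. iff some such path
-- has total decoration ≤ m.
PrContrAdj : ∀ {n} → DecGraph n → ℕ → Subset n → Subset n → Fin n → Fin n → Set
PrContrAdj G m F S u v =
  u ∈ F × u ∉ S × v ∈ F × v ∉ S × u ≢ v ×
  ∃ λ d → d Data.Nat.≤ m × IWalk G (S ∩ F) u v d

-- Connected components of a graph with vertex set V and edge relation E
-- (E only relates vertices of V); a component is the vertex set of a
-- reachability class.
IsComponent : ∀ {n} → Subset n → (Fin n → Fin n → Set) → Subset n → Set
IsComponent V E C = ∃ λ v → v ∈ V × (∀ u → (u ∈ C) ⇔ Star E v u)

NumComponents : ∀ {n} → Subset n → (Fin n → Fin n → Set) → ℕ → Set
NumComponents V E k = Card (IsComponent V E) k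

-- Flags  ∅ = F₀ ⊂ F₁ ⊂ … ⊂ F_k = [n], represented by the list F₁ … F_k.

ChainFrom : ∀ {n} → Subset n → List (Subset n) → Set
ChainFrom prev []       = prev ≡ ⊤
ChainFrom prev (F ∷ Fs) = prev ⊂ F × ChainFrom F Fs

IsFlag : ∀ {n} → List (Subset n) → Set
IsFlag Fs = ChainFrom ⊥ Fs

typeFrom : ∀ {n} → Subset n → List (Subset n) → List ℕ
typeFrom prev []       = []
typeFrom prev (F ∷ Fs) = (∣ F ∣ ∸ ∣ prev ∣) ∷ typeFrom F Fs

flagType : ∀ {n} → List (Subset n) → List ℕ
flagType Fs = typeFrom ⊥ Fs

CompsFrom : ∀ {n} → DecGraph n → ℕ → Subset n → List (Subset n) → List ℕ → Set
CompsFrom G m prev []       []       = Data.Unit.⊤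
  where import Data.Unit
CompsFrom G m prev []       (_ ∷ _)  = Data.Empty.⊥
  where import Data.Empty
CompsFrom G m prev (F ∷ Fs) []       = Data.Empty.⊥
  where import Data.Empty
CompsFrom G m prev (F ∷ Fs) (c ∷ cs) =
  NumComponents (F Data.Fin.Subset.─ prev) (PrContrAdj G m F prev) c × CompsFrom G m F Fs cs

RankIs : ∀ {n} → DecGraph n → ℕ → List (Subset n) → ℕ → Set
RankIs {n} G m Fs r = ∃ λ cs → CompsFrom G m ⊥ Fs cs × r ≡ n ∸ sum cs

-- Ψ^m_q(Γ^w) = Σ_F q^{rk_m(Γ^w/F)} M_{type F}.  Since the M_α are a basis,
-- Ψ^m_q(Γ^w) is determined by its coefficients:
-- PsiCoeff G m α r N  :  the coefficient of q^r M_α in Ψ^m_q(Γ^w) is N,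
-- i.e. exactly N flags have type α and rank r.
PsiCoeff : ∀ {n} → DecGraph n → ℕ → List ℕ → ℕ → ℕ → Set
PsiCoeff {n} G m α r N =
  Card {List (Subset n)} (λ Fs → IsFlag Fs × flagType Fs ≡ α × RankIs G m Fs r) N

PsiEq : ∀ {n} → DecGraph n → ℕ → ℕ → Set
PsiEq G k m = ∀ α r N → PsiCoeff G k α r N ⇔ PsiCoeff G m α r N

{-# OPTIONS --safe #-}
module Submission where

-- In Γ^𝟏 the decoration of a walk is its number of edges.  A walk from u to v
-- whose interior avoids v can be shortcut to an induced path of Γ with the same
-- endpoints and interior among the old interior vertices; by maximality of M that
-- path has at most ∣M∣ vertices, hence decoration at most ∣M∣ - 1.  So for
-- k ≥ ∣M∣ the graphs pr_k(Γ^𝟏|_F / S) and pr_{∣M∣-1}(Γ^𝟏|_F / S) have the same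
-- edges, and all component counts, ranks and coefficients of Ψ agree.

open import Defs
open import Data.Nat using (ℕ; _≤_; _∸_)
open import Data.Fin.Subset using (Subset; ∣_∣)

open import Data.Nat using (suc; _+_)
open import Data.Nat.Properties using (≤-trans; ∸-monoˡ-≤; m∸n≤m; +-comm; suc-injective)
open import Data.Bool using (true; false; T; T?)
open import Data.Fin using (Fin; zero; suc; _≟_)
open import Data.Fin.Subset using (_∈_; _∉_; _∩_; _∪_; ⁅_⁆; ⊥)
open import Data.Fin.Subset.Properties
  using (∉⊥; ∣⊥∣≡0; x∈⁅x⁆; x∈⁅y⁆⇒x≡y; x∈p∪q⁺; x∈p∪q⁻; x∈p∩q⁻; ∪-identityˡ)
open import Data.Vec using (_∷_; here; there)
open import Data.List using (List; []; _∷_; _++_; [_]; length; lookup)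
open import Data.List.Properties using (length-++)
open import Data.List.Relation.Unary.All using (All; []; _∷_)
import Data.List.Relation.Unary.All as All
open import Data.List.Relation.Unary.Any using (here; there; index)
open import Data.List.Relation.Unary.Any.Properties using (lookup-index)
open import Data.List.Relation.Unary.AllPairs using ([]; _∷_)
open import Data.List.Relation.Unary.Unique.Propositional using (Unique)
open import Data.List.Relation.Unary.Unique.Propositional.Properties using (Unique[x∷xs]⇒x∉xs)
open import Data.List.Membership.Propositional using () renaming (_∈_ to _∈ₗ_)
open import Data.List.Membership.Propositional.Properties using (∈-lookup)
open import Data.Product using (∃; _×_; _,_; proj₁; proj₂)
open import Data.Product.Function.NonDependent.Propositional using (_×-⇔_)
import Data.Product.Function.Dependent.Propositional as Σ
open import Data.Sum using (_⊎_; inj₁; inj₂)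
import Data.Sum as Sum
open import Data.Unit using (tt) renaming (⊤ to Unit)
open import Data.Empty using (⊥-elim)
open import Relation.Nullary using (¬_; yes; no)
open import Relation.Binary.PropositionalEquality using (_≡_; _≢_; refl; trans; cong; subst)
import Relation.Binary.PropositionalEquality as ≡
open ≡.≡-Reasoning
open import Relation.Binary.Construct.Closure.ReflexiveTransitive using (Star)
import Relation.Binary.Construct.Closure.ReflexiveTransitive as Star
open import Function using (_⇔_; mk⇔; _∘_)
open import Function.Bundles using (module Equivalence)
open Equivalence using (to; from)
open import Function.Properties.Equivalence using ()
  renaming (refl to ⇔-refl; sym to ⇔-sym; trans to ⇔-trans)
open import Function.Definitions using (Injective)

fromList : ∀ {n} → List (Fin n) → Subset n
fromList []       = ⊥
fromList (x ∷ xs) = ⁅ x ⁆ ∪ fromList xs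

∈-fromList⁺ : ∀ {n} {x : Fin n} {xs} → x ∈ₗ xs → x ∈ fromList xs
∈-fromList⁺ {xs = y ∷ _}  (here refl)  = x∈p∪q⁺ (inj₁ (x∈⁅x⁆ y))
∈-fromList⁺ {xs = _ ∷ _}  (there x∈xs) = x∈p∪q⁺ (inj₂ (∈-fromList⁺ x∈xs))

∈-fromList⁻ : ∀ {n} {x : Fin n} xs → x ∈ fromList xs → x ∈ₗ xs
∈-fromList⁻ []       x∈ = ⊥-elim (∉⊥ x∈)
∈-fromList⁻ (y ∷ ys) x∈ with x∈p∪q⁻ ⁅ y ⁆ (fromList ys) x∈
... | inj₁ x∈⁅y⁆ = here (x∈⁅y⁆⇒x≡y y x∈⁅y⁆)
... | inj₂ x∈ys  = there (∈-fromList⁻ ys x∈ys)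

∣⁅x⁆∪p∣≡1+∣p∣ : ∀ {n} (x : Fin n) p → x ∉ p → ∣ ⁅ x ⁆ ∪ p ∣ ≡ suc ∣ p ∣
∣⁅x⁆∪p∣≡1+∣p∣ zero    (true  ∷ p) x∉p = ⊥-elim (x∉p here)
∣⁅x⁆∪p∣≡1+∣p∣ zero    (false ∷ p) _   = cong (suc ∘ ∣_∣) (∪-identityˡ p)
∣⁅x⁆∪p∣≡1+∣p∣ (suc x) (true  ∷ p) x∉p = cong suc (∣⁅x⁆∪p∣≡1+∣p∣ x p (x∉p ∘ there))
∣⁅x⁆∪p∣≡1+∣p∣ (suc x) (false ∷ p) x∉p = ∣⁅x⁆∪p∣≡1+∣p∣ x p (x∉p ∘ there)

∣fromList∣≡length : ∀ {n} {xs : List (Fin n)} → Unique xs → ∣ fromList xs ∣ ≡ length xs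
∣fromList∣≡length {n} {[]}     []             = ∣⊥∣≡0 n
∣fromList∣≡length {xs = x ∷ xs} unique@(_ ∷ uniqueˢ) =
  trans (∣⁅x⁆∪p∣≡1+∣p∣ x (fromList xs) (Unique[x∷xs]⇒x∉xs unique ∘ ∈-fromList⁻ xs))
        (cong suc (∣fromList∣≡length uniqueˢ))

lookup-injective : ∀ {A : Set} {xs : List A} → Unique xs → Injective _≡_ _≡_ (lookup xs)
lookup-injective {xs = x ∷ xs} _ {zero} {zero} _ = refl
lookup-injective {xs = x ∷ xs} unique {zero} {suc j} x≡xsⱼ =
  ⊥-elim (Unique[x∷xs]⇒x∉xs unique (subst (_∈ₗ xs) (≡.sym x≡xsⱼ) (∈-lookup j)))
lookup-injective {xs = x ∷ xs} unique {suc i} {zero} xsᵢ≡x =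
  ⊥-elim (Unique[x∷xs]⇒x∉xs unique (subst (_∈ₗ xs) xsᵢ≡x (∈-lookup i)))
lookup-injective {xs = x ∷ xs} (_ ∷ unique) {suc i} {suc j} xsᵢ≡xsⱼ =
  cong suc (lookup-injective unique xsᵢ≡xsⱼ)

Star-cong : ∀ {n} {E E′ : Fin n → Fin n → Set} →
            (∀ u v → E u v ⇔ E′ u v) → ∀ u v → Star E u v ⇔ Star E′ u v
Star-cong E⇔E′ _ _ =
  mk⇔ (Star.map (λ {u} {v} → to (E⇔E′ u v))) (Star.map (λ {u} {v} → from (E⇔E′ u v)))

IsComponent-cong : ∀ {n} {V : Subset n} {E E′ : Fin n → Fin n → Set} →
                   (∀ u v → E u v ⇔ E′ u v) → ∀ C → IsComponent V E C ⇔ IsComponent V E′ C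
IsComponent-cong {V = V} E⇔E′ C = mk⇔ (retarget E⇔E′) (retarget (λ u v → ⇔-sym (E⇔E′ u v)))
  where
  retarget : ∀ {E E′} → (∀ u v → E u v ⇔ E′ u v) → IsComponent V E C → IsComponent V E′ C
  retarget h (v , v∈V , C≡reach) = v , v∈V , λ u → ⇔-trans (C≡reach u) (Star-cong h v u)

Card-cong : ∀ {A : Set} {P Q : A → Set} {k} → (∀ x → P x ⇔ Q x) → Card P k ⇔ Card Q k
Card-cong {k = k} P⇔Q = mk⇔ (retarget P⇔Q) (retarget (⇔-sym ∘ P⇔Q))
  where
  retarget : ∀ {P Q} → (∀ x → P x ⇔ Q x) → Card P k → Card Q k
  retarget h (xs , unique , enumerates , length≡) =
    xs , unique , (λ x → ⇔-trans (enumerates x) (h x)) , length≡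

module _ {n} {G : DecGraph n} {k m : ℕ}
         (PrContrAdj-⇔ : ∀ F S u v → PrContrAdj G k F S u v ⇔ PrContrAdj G m F S u v) where

  CompsFrom-cong : ∀ prev Fs cs → CompsFrom G k prev Fs cs ⇔ CompsFrom G m prev Fs cs
  CompsFrom-cong prev []       []       = ⇔-refl
  CompsFrom-cong prev []       (_ ∷ _)  = ⇔-refl
  CompsFrom-cong prev (_ ∷ _)  []       = ⇔-refl
  CompsFrom-cong prev (F ∷ Fs) (c ∷ cs) =
    Card-cong (IsComponent-cong (PrContrAdj-⇔ F prev)) ×-⇔ CompsFrom-cong F Fs cs

  RankIs-cong : ∀ Fs r → RankIs G k Fs r ⇔ RankIs G m Fs r
  RankIs-cong Fs r = Σ.congˡ (λ {cs} → CompsFrom-cong ⊥ Fs cs ×-⇔ ⇔-refl)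

  PrContrAdj-⇔⇒PsiEq : PsiEq G k m
  PrContrAdj-⇔⇒PsiEq α r N = Card-cong λ Fs → ⇔-refl ×-⇔ ⇔-refl ×-⇔ RankIs-cong Fs r

PrContrAdj-mono : ∀ {n} (G : DecGraph n) {m k} → m ≤ k →
                  ∀ {F S u v} → PrContrAdj G m F S u v → PrContrAdj G k F S u v
PrContrAdj-mono G m≤k (u∈F , u∉S , v∈F , v∉S , u≢v , d , d≤m , walk) =
  u∈F , u∉S , v∈F , v∉S , u≢v , d , ≤-trans d≤m m≤k , walk

LAdj-suc⇔ : ∀ {r} {i j : Fin r} → LAdj (suc i) (suc j) ⇔ LAdj i j
LAdj-suc⇔ = mk⇔ (Sum.map suc-injective suc-injective) (Sum.map (cong suc) (cong suc))

LAdj-sym⇔ : ∀ {r} {i j : Fin r} → LAdj i j ⇔ LAdj j i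
LAdj-sym⇔ = mk⇔ Sum.swap Sum.swap

module InducedPaths {n} (Γ : SimpleGraph n) where

  Adj-irrefl : ∀ x → ¬ Adj Γ x x
  Adj-irrefl x = subst T (irrefl Γ x)

  Adj-sym⇔ : ∀ {x y} → Adj Γ x y ⇔ Adj Γ y x
  Adj-sym⇔ {x} {y} = mk⇔ (subst T (SimpleGraph.sym Γ x y)) (subst T (SimpleGraph.sym Γ y x))

  Adj⇒≢ : ∀ {x y} → Adj Γ x y → x ≢ y
  Adj⇒≢ x~y refl = Adj-irrefl _ x~y

  Far : Fin n → List (Fin n) → Set
  Far x = All (λ z → x ≢ z × ¬ Adj Γ x z)

  IsInducedPath : List (Fin n) → Set
  IsInducedPath []          = Unit
  IsInducedPath (_ ∷ [])    = Unit
  IsInducedPath (x ∷ y ∷ r) = Adj Γ x y × Far x r × IsInducedPath (y ∷ r)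

  IsInducedPath-tail : ∀ x ps → IsInducedPath (x ∷ ps) → IsInducedPath ps
  IsInducedPath-tail _ []      _           = tt
  IsInducedPath-tail _ (_ ∷ _) (_ , _ , p) = p

  IsInducedPath⇒Unique : ∀ ps → IsInducedPath ps → Unique ps
  IsInducedPath⇒Unique []          _               = []
  IsInducedPath⇒Unique (_ ∷ [])    _               = [] ∷ []
  IsInducedPath⇒Unique (_ ∷ y ∷ r) (x~y , far , p) =
    (Adj⇒≢ x~y ∷ All.map proj₁ far) ∷ IsInducedPath⇒Unique (y ∷ r) p

  lookup₀-Adj⇔LAdj : ∀ x r → IsInducedPath (x ∷ r) → ∀ j → Adj Γ x (lookup (x ∷ r) j) ⇔ LAdj zero j
  lookup₀-Adj⇔LAdj x _ _ zero =
    mk⇔ (⊥-elim ∘ Adj-irrefl x) λ { (inj₁ ()) ; (inj₂ ()) }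
  lookup₀-Adj⇔LAdj _ (_ ∷ _) (x~y , _ , _) (suc zero) = mk⇔ (λ _ → inj₁ refl) (λ _ → x~y)
  lookup₀-Adj⇔LAdj _ (_ ∷ _) (_ , far , _) (suc (suc j)) =
    mk⇔ (⊥-elim ∘ proj₂ (All.lookup far (∈-lookup j))) λ { (inj₁ ()) ; (inj₂ ()) }

  lookup-Adj⇔LAdj : ∀ ps → IsInducedPath ps → ∀ i j → Adj Γ (lookup ps i) (lookup ps j) ⇔ LAdj i j
  lookup-Adj⇔LAdj (x ∷ r) p zero j = lookup₀-Adj⇔LAdj x r p j
  lookup-Adj⇔LAdj (x ∷ r@(_ ∷ _)) p (suc i) zero =
    ⇔-trans Adj-sym⇔ (⇔-trans (lookup₀-Adj⇔LAdj x r p (suc i)) LAdj-sym⇔)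
  lookup-Adj⇔LAdj (_ ∷ y ∷ r) (_ , _ , p) (suc i) (suc j) =
    ⇔-trans (lookup-Adj⇔LAdj (y ∷ r) p i j) (⇔-sym LAdj-suc⇔)

  IsPathEnumeration : Subset n → (L : ℕ) → (Fin L → Fin n) → Set
  IsPathEnumeration M L f =
      (∀ i → f i ∈ M)
    × Injective _≡_ _≡_ f
    × (∀ x → x ∈ M → ∃ λ i → f i ≡ x)
    × (∀ i j → Adj Γ (f i) (f j) ⇔ LAdj i j)

  inducedPath : ∀ {M L} → ∣ M ∣ ≡ L → ∀ f → IsPathEnumeration M L f → InducedPath Γ M
  inducedPath refl f enumeration = f , enumeration

  InducedPath-fromList : ∀ ps → IsInducedPath ps → InducedPath Γ (fromList ps)
  InducedPath-fromList ps p = inducedPath (∣fromList∣≡length unique) (lookup ps)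
    ( (λ i → ∈-fromList⁺ (∈-lookup {xs = ps} i))
    , lookup-injective unique
    , (λ x x∈ → let x∈ps = ∈-fromList⁻ ps x∈ in index x∈ps , ≡.sym (lookup-index x∈ps))
    , lookup-Adj⇔LAdj ps p )
    where unique = IsInducedPath⇒Unique ps p

  module _ (I : Subset n) where

    InducedPathThrough : Fin n → Fin n → Set
    InducedPathThrough u v = ∃ λ ys → All (_∈ I) ys × IsInducedPath (u ∷ ys ++ [ v ])

    -- a is attached at the last vertex of the path equal or adjacent to it,
    -- so it is far from everything after that vertex.
    attach : ∀ a zs b → a ≢ b → All (_∈ I) zs → IsInducedPath (zs ++ [ b ]) →
             Far a (zs ++ [ b ]) ⊎ InducedPathThrough a b
    attach a [] b a≢b [] _ with T? (adj Γ a b)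
    ... | yes a~b = inj₂ ([] , [] , a~b , [] , tt)
    ... | no ¬a~b = inj₁ ((a≢b , ¬a~b) ∷ [])
    attach a (c ∷ zs) b a≢b (c∈I ∷ zs⊆I) p
      with attach a zs b a≢b zs⊆I (IsInducedPath-tail c (zs ++ [ b ]) p)
    ... | inj₂ path = inj₂ path
    ... | inj₁ far with a ≟ c
    ...   | yes refl = inj₂ (zs , zs⊆I , p)
    ...   | no a≢c with T? (adj Γ a c)
    ...     | yes a~c = inj₂ (c ∷ zs , c∈I ∷ zs⊆I , a~c , far , p)
    ...     | no ¬a~c = inj₁ ((a≢c , ¬a~c) ∷ far)

    shortcut : ∀ {u v d} → IWalk (Γ ^𝟏) I u v d → u ≢ v → v ∉ I → InducedPathThrough u v
    shortcut (edge u~v) _ _ = [] , [] , u~v , [] , tt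
    shortcut (step {x = x} u~x x∈I walk) u≢v v∉I
      with shortcut walk (λ { refl → v∉I x∈I }) v∉I
    ... | ys , ys⊆I , p with attach _ (x ∷ ys) _ u≢v (x∈I ∷ ys⊆I) p
    ...   | inj₁ ((_ , ¬u~x) ∷ _) = ⊥-elim (¬u~x u~x)
    ...   | inj₂ path             = path

    IsInducedPath⇒IWalk : ∀ u ys v → All (_∈ I) ys → IsInducedPath (u ∷ ys ++ [ v ]) →
                          IWalk (Γ ^𝟏) I u v (suc (length ys))
    IsInducedPath⇒IWalk u []       v []           (u~v , _)     = edge u~v
    IsInducedPath⇒IWalk u (y ∷ ys) v (y∈I ∷ ys⊆I) (u~y , _ , p) =
      step u~y y∈I (IsInducedPath⇒IWalk y ys v ys⊆I p)

  PrContrAdj-tighten : ∀ {b k F S u v} → (∀ M → InducedPath Γ M → ∣ M ∣ ≤ b) →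
                       PrContrAdj (Γ ^𝟏) k F S u v → PrContrAdj (Γ ^𝟏) (b ∸ 1) F S u v
  PrContrAdj-tighten {b} {F = F} {S} {u} {v} pathBound (u∈F , u∉S , v∈F , v∉S , u≢v , _ , _ , walk)
    with shortcut (S ∩ F) walk u≢v (v∉S ∘ proj₁ ∘ x∈p∩q⁻ S F)
  ... | ys , ys⊆I , p =
    u∈F , u∉S , v∈F , v∉S , u≢v , suc (length ys) , ∸-monoˡ-≤ 1 vertices≤b ,
    IsInducedPath⇒IWalk (S ∩ F) u ys v ys⊆I p
    where
    vertices : ∣ fromList (u ∷ ys ++ [ v ]) ∣ ≡ suc (suc (length ys))
    vertices = begin
      ∣ fromList (u ∷ ys ++ [ v ]) ∣ ≡⟨ ∣fromList∣≡length (IsInducedPath⇒Unique _ p) ⟩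
      suc (length (ys ++ [ v ]))     ≡⟨ cong suc (length-++ ys) ⟩
      suc (length ys + 1)            ≡⟨ cong suc (+-comm (length ys) 1) ⟩
      suc (suc (length ys))          ∎

    vertices≤b : suc (suc (length ys)) ≤ b
    vertices≤b = subst (_≤ b) vertices (pathBound _ (InducedPath-fromList _ p))

open InducedPaths using (PrContrAdj-tighten)

mainTheorem3 : ∀ {n} (Γ : SimpleGraph n) → Connected Γ →
    (M : Subset n) → InducedPath Γ M →
    (∀ M′ → InducedPath Γ M′ → ∣ M′ ∣ ≤ ∣ M ∣) →
    ∀ k → ∣ M ∣ ≤ k → PsiEq (Γ ^𝟏) k (∣ M ∣ ∸ 1)
mainTheorem3 Γ _ M _ M-maximal k ∣M∣≤k = PrContrAdj-⇔⇒PsiEq λ _ _ _ _ →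
  mk⇔ (PrContrAdj-tighten Γ M-maximal)
      (PrContrAdj-mono (Γ ^𝟏) (≤-trans (m∸n≤m ∣ M ∣ 1) ∣M∣≤k))
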